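{- Let $t\geq 2$ and $k\geq 3t-2$ be integers. Then $A_{k,t}$ has an isolation set of size $k-t+1$.
   Context: $[k]=\{1,\dots,k\}$ and $A_{k,t}$ is the Boolean matrix with rows and columns indexed by all $t$-subsets of $[k]$, with entry $1$ at $(x,y)$ iff $x\cap y\neq\emptyset$. An isolation set of a Boolean matrix $B$ is a set $F$ of entries of $B$ all equal to $1$, such that no two entries of $F$ lie in the same row or column, and no two entries of $F$ lie in a common $2\times 2$ all-ones submatrix of $B$ (i.e., for distinct entries $(i,j),(i',j')\in F$, $B[i][j']=0$ or $B[i'][j]=0$). -}

module Defs where

open import Data.Nat using (ℕ; _≡ᵇ_)
open import Data.Fin using (Fin)
open import Data.Fin.Subset using (Subset; ∣_∣; _∈_)
open import Data.Product using (Σ; ∃; _×_; proj₁)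
open import Relation.Binary.PropositionalEquality using (_≡_; _≢_)
open import Relation.Nullary using (¬_)

TSubset : ℕ → ℕ → Set
TSubset k t = Σ (Subset k) (λ x → ∣ x ∣ ≡ t)

-- entry of A_{k,t} at (x,y) is 1 iff x ∩ y ≠ ∅
A : (k t : ℕ) → TSubset k t → TSubset k t → Set
A k t x y = ∃ λ (i : Fin k) → (i ∈ proj₁ x) × (i ∈ proj₁ y)

record IsolationSet {R C : Set} (B : R → C → Set) (m : ℕ) : Set where
  field
    row : Fin m → R
    col : Fin m → C
    ones : ∀ i → B (row i) (col i)
    rowsDistinct : ∀ i j → i ≢ j → row i ≢ row j
    colsDistinct : ∀ i j → i ≢ j → col i ≢ col j
    isolated : ∀ i j → i ≢ j → ¬ (B (row i) (col j) × B (row j) (col i))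

-- Take k = c + m points: a core of c = t − 1 points followed by a cycle of m = k − t + 1 points.
-- Row i is the core together with the i-th cycle point, column j is the window of t consecutive
-- cycle points starting at the j-th one, so row i meets column j exactly when i lies in the
-- cyclic window of length t starting at j. Two distinct indices cannot each lie in the other's
-- window: the two cyclic distances would add up to m, yet each is at most t − 1 and m ≥ 2t − 1.
module Submission where

open import Data.Bool using (Bool; true; false; _∨_; T)
open import Data.Bool.Properties using (T-∨; T-≡)
open import Data.Empty using (⊥; ⊥-elim)
open import Data.Fin using (Fin; toℕ; _↑ʳ_)
open import Data.Fin.Properties using (toℕ-↑ʳ; toℕ<n; toℕ-injective)
open import Data.Fin.Subset using (Subset; ∣_∣; _∈_)
open import Data.Nat using (ℕ; zero; suc; _≤_; _<_; _+_; _*_; _∸_; _⊓_; z≤n; s≤s)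
open import Data.Nat.Properties
open import Data.Nat.Tactic.RingSolver using (solve-∀)
open import Data.Product using (_×_; _,_; proj₁; proj₂)
open import Data.Sum using (_⊎_; inj₁; inj₂)
open import Data.Vec using (_∷_; tabulate)
open import Data.Vec.Properties using (lookup∘tabulate; []=⇒lookup; lookup⇒[]=)
open import Function using (_∘_; flip; Equivalence)
open import Relation.Binary.Definitions using (Antisymmetric)
open import Relation.Binary.PropositionalEquality
open import Relation.Nullary using (¬_)

open import Defs

open Equivalence using (to; from)

isolationSet-fromAntisymmetric :
  ∀ {ℓ} {R C : Set} {B : R → C → Set} {m} (_≼_ : Fin m → Fin m → Set ℓ)
  (row : Fin m → R) (col : Fin m → C) →
  (∀ i → B (row i) (col i)) →
  (∀ {i j} → B (row i) (col j) → i ≼ j) →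
  Antisymmetric _≡_ _≼_ →
  IsolationSet B m
isolationSet-fromAntisymmetric {B = B} _≼_ row col ones supported antisym = record
  { row = row
  ; col = col
  ; ones = ones
  ; rowsDistinct = λ i j i≢j eq → isolated i j i≢j
      (subst (λ r → B r (col j)) (sym eq) (ones j) , subst (λ r → B r (col i)) eq (ones i))
  ; colsDistinct = λ i j i≢j eq → isolated i j i≢j
      (subst (B (row i)) eq (ones i) , subst (B (row j)) (sym eq) (ones j))
  ; isolated = isolated
  }
  where
  isolated : ∀ i j → i ≢ j → ¬ (B (row i) (col j) × B (row j) (col i))
  isolated i j i≢j (bij , bji) = i≢j (antisym (supported bij) (supported bji))

fromPred : (n : ℕ) → (ℕ → Bool) → Subset n
fromPred n f = tabulate (f ∘ toℕ)

∈fromPred⁺ : ∀ {n} (f : ℕ → Bool) (z : Fin n) → T (f (toℕ z)) → z ∈ fromPred n f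
∈fromPred⁺ f z fz = lookup⇒[]= z _ (trans (lookup∘tabulate (f ∘ toℕ) z) (to T-≡ fz))

∈fromPred⁻ : ∀ {n} (f : ℕ → Bool) (z : Fin n) → z ∈ fromPred n f → T (f (toℕ z))
∈fromPred⁻ f z z∈ = from T-≡ (trans (sym (lookup∘tabulate (f ∘ toℕ) z)) ([]=⇒lookup z∈))

∣fromPred-∨∣ : ∀ n (f g : ℕ → Bool) → (∀ q → T (f q) → T (g q) → ⊥) →
               ∣ fromPred n (λ q → f q ∨ g q) ∣ ≡ ∣ fromPred n f ∣ + ∣ fromPred n g ∣
∣fromPred-∨∣ zero    f g disjoint = refl
∣fromPred-∨∣ (suc n) f g disjoint =
  ∣∨∷∣ (f 0) (g 0) (fromPred n (f ∘ suc)) (fromPred n (g ∘ suc))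
    (fromPred n (λ q → f (suc q) ∨ g (suc q))) (disjoint 0) (∣fromPred-∨∣ n (f ∘ suc) (g ∘ suc) (disjoint ∘ suc))
  where
  ∣∨∷∣ : ∀ x y (p q r : Subset n) → (T x → T y → ⊥) → ∣ r ∣ ≡ ∣ p ∣ + ∣ q ∣ →
         ∣ (x ∨ y) ∷ r ∣ ≡ ∣ x ∷ p ∣ + ∣ y ∷ q ∣
  ∣∨∷∣ true  true  _ _ _ disj _ = ⊥-elim (disj _ _)
  ∣∨∷∣ true  false _ _ _ _    e = cong suc e
  ∣∨∷∣ false true  _ _ _ _    e = trans (cong suc e) (sym (+-suc _ _))
  ∣∨∷∣ false false _ _ _ _    e = e

interval : ℕ → ℕ → ℕ → Bool
interval (suc a) l       (suc q) = interval a l q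
interval (suc a) l       zero    = false
interval zero    (suc l) zero    = true
interval zero    (suc l) (suc q) = interval zero l q
interval zero    zero    q       = false

interval⁻ : ∀ a l q → T (interval a l q) → a ≤ q × q < a + l
interval⁻ (suc a) l       (suc q) q∈ = let a≤q , q<a+l = interval⁻ a l q q∈ in s≤s a≤q , s≤s q<a+l
interval⁻ zero    (suc l) zero    _  = z≤n , s≤s z≤n
interval⁻ zero    (suc l) (suc q) q∈ = z≤n , s≤s (proj₂ (interval⁻ zero l q q∈))

interval-singleton : ∀ a q → T (interval a 1 q) → q ≡ a
interval-singleton zero    zero    _  = refl
interval-singleton (suc a) (suc q) q∈ = cong suc (interval-singleton a q q∈)

start∈interval : ∀ a l → T (interval a (suc l) a)
start∈interval zero    l = _
start∈interval (suc a) l = start∈interval a l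

interval-disjoint : ∀ {a l b l′} → a + l ≤ b →
                    ∀ q → T (interval a l q) → T (interval b l′ q) → ⊥
interval-disjoint {a} {l} {b} {l′} a+l≤b q q∈ q∈′ =
  <⇒≱ (proj₂ (interval⁻ a l q q∈)) (≤-trans a+l≤b (proj₁ (interval⁻ b l′ q q∈′)))

∣fromPred-interval∣ : ∀ n a l → ∣ fromPred n (interval a l) ∣ ≡ (n ∸ a) ⊓ l
∣fromPred-interval∣ zero    zero    l       = refl
∣fromPred-interval∣ zero    (suc a) l       = refl
∣fromPred-interval∣ (suc n) zero    zero    = trans (∣fromPred-interval∣ n 0 0) (⊓-zeroʳ n)
∣fromPred-interval∣ (suc n) zero    (suc l) = cong suc (∣fromPred-interval∣ n 0 l)
∣fromPred-interval∣ (suc n) (suc a) l       = ∣fromPred-interval∣ n a l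

∣fromPred-interval∣-≤ : ∀ {n} a l → a + l ≤ n → ∣ fromPred n (interval a l) ∣ ≡ l
∣fromPred-interval∣-≤ {n} a l a+l≤n =
  trans (∣fromPred-interval∣ n a l) (m≥n⇒m⊓n≡n (m+n≤o⇒m≤o∸n l (subst (_≤ n) (+-comm a l) a+l≤n)))

m<n∸o⇒m+o<n : ∀ m n o → m < n ∸ o → m + o < n
m<n∸o⇒m+o<n m n       zero    m<n = subst (_< n) (sym (+-identityʳ m)) m<n
m<n∸o⇒m+o<n m (suc n) (suc o) m<n = subst (_< suc n) (sym (+-suc m o)) (s≤s (m<n∸o⇒m+o<n m n o m<n))

-- Window m t j i: i lies in {j, j + 1, …, j + t − 1} modulo m (for i, j < m)
Window : (m t j i : ℕ) → Set
Window m t j i = (j ≤ i × i < j + t) ⊎ i + m < j + t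

¬wrapped : ∀ {m t a b} → t + t ≤ suc m → a + m < b + t → b < a + t → ⊥
¬wrapped {m} {t} {a} {b} t+t≤1+m a+m<b+t b<a+t = n≮n (suc m) (≤-trans 2+m≤t+t t+t≤1+m)
  where
  2+m≤t+t : suc (suc m) ≤ t + t
  2+m≤t+t = +-cancelʳ-≤ (a + b) (suc (suc m)) (t + t) (begin
    suc (suc m) + (a + b) ≡⟨ regroupˡ m a b ⟩
    suc (a + m) + suc b   ≤⟨ +-mono-≤ a+m<b+t b<a+t ⟩
    (b + t) + (a + t)     ≡⟨ regroupʳ t a b ⟩
    (t + t) + (a + b)     ∎)
    where
    open ≤-Reasoning
    regroupˡ : ∀ m a b → suc (suc m) + (a + b) ≡ suc (a + m) + suc b
    regroupˡ = solve-∀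
    regroupʳ : ∀ t a b → (b + t) + (a + t) ≡ (t + t) + (a + b)
    regroupʳ = solve-∀

window-antisym : ∀ {m t i j} → t + t ≤ suc m → Window m t j i → Window m t i j → i ≡ j
window-antisym _    (inj₁ (j≤i , _))    (inj₁ (i≤j , _))    = ≤-antisym i≤j j≤i
window-antisym 2t≤  (inj₁ (_ , i<j+t))  (inj₂ j+m<i+t)      = ⊥-elim (¬wrapped 2t≤ j+m<i+t i<j+t)
window-antisym 2t≤  (inj₂ i+m<j+t)      (inj₁ (_ , j<i+t))  = ⊥-elim (¬wrapped 2t≤ i+m<j+t j<i+t)
window-antisym {m} {i = i} 2t≤ (inj₂ i+m<j+t) (inj₂ j+m<i+t) =
  ⊥-elim (¬wrapped 2t≤ j+m<i+t (≤-<-trans (m≤m+n i m) i+m<j+t))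

module Construction (c m : ℕ) (c+c<m : c + c < m) where

  t≤m : suc c ≤ m
  t≤m = ≤-trans (s≤s (m≤m+n c c)) c+c<m

  t+t≤1+m : suc c + suc c ≤ suc m
  t+t≤1+m = s≤s (subst (_≤ m) (sym (+-suc c c)) c+c<m)

  rowPred : ℕ → ℕ → Bool
  rowPred i q = interval 0 c q ∨ interval (c + i) 1 q

  -- column j: the window [c + j, c + j + t) cut off at the end of the cycle,
  -- continued by the first wrap j cycle points
  wrap : ℕ → ℕ
  wrap j = suc c ∸ (m ∸ j)

  colPred : ℕ → ℕ → Bool
  colPred j q = interval (c + j) (suc c) q ∨ interval c (wrap j) q

  ∣rowPred∣ : ∀ {i} → i < m → ∣ fromPred (c + m) (rowPred i) ∣ ≡ suc c
  ∣rowPred∣ {i} i<m = begin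
    ∣ fromPred (c + m) (rowPred i) ∣
      ≡⟨ ∣fromPred-∨∣ (c + m) (interval 0 c) (interval (c + i) 1)
                       (interval-disjoint {0} {c} {c + i} {1} (m≤m+n c i)) ⟩
    ∣ fromPred (c + m) (interval 0 c) ∣ + ∣ fromPred (c + m) (interval (c + i) 1) ∣
      ≡⟨ cong₂ _+_ (∣fromPred-interval∣-≤ 0 c (m≤m+n c m))
                   (∣fromPred-interval∣-≤ (c + i) 1 c+i+1≤c+m) ⟩
    c + 1
      ≡⟨ +-comm c 1 ⟩
    suc c ∎
    where
    open ≡-Reasoning
    c+i+1≤c+m : c + i + 1 ≤ c + m
    c+i+1≤c+m = ≤-trans (≤-reflexive (trans (+-assoc c i 1) (cong (c +_) (+-comm i 1))))
                        (+-monoʳ-≤ c i<m)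

  ∣colPred∣ : ∀ {j} → j < m → ∣ fromPred (c + m) (colPred j) ∣ ≡ suc c
  ∣colPred∣ {j} j<m = begin
    ∣ fromPred (c + m) (colPred j) ∣
      ≡⟨ ∣fromPred-∨∣ (c + m) (interval (c + j) (suc c)) (interval c (wrap j))
           (λ q → flip (interval-disjoint {c} {wrap j} {c + j} {suc c} wrap≤start q)) ⟩
    ∣ fromPred (c + m) (interval (c + j) (suc c)) ∣ + ∣ fromPred (c + m) (interval c (wrap j)) ∣
      ≡⟨ cong₂ _+_ (trans (∣fromPred-interval∣ (c + m) (c + j) (suc c))
                          (cong (_⊓ suc c) ([m+n]∸[m+o]≡n∸o c m j)))
                   (∣fromPred-interval∣-≤ c (wrap j)
                      (+-monoʳ-≤ c (≤-trans (m∸n≤m (suc c) (m ∸ j)) t≤m))) ⟩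
    (m ∸ j) ⊓ suc c + wrap j
      ≡⟨ m⊓n+n∸m≡n (m ∸ j) (suc c) ⟩
    suc c ∎
    where
    open ≡-Reasoning
    wrap≤start : c + wrap j ≤ c + j
    wrap≤start = +-monoʳ-≤ c (m≤n+o⇒m∸n≤o (suc c) (m ∸ j)
                   (≤-trans t≤m (≤-reflexive (sym (m∸n+n≡m (<⇒≤ j<m))))))

  row : Fin m → TSubset (c + m) (suc c)
  row i = fromPred (c + m) (rowPred (toℕ i)) , ∣rowPred∣ (toℕ<n i)

  col : Fin m → TSubset (c + m) (suc c)
  col j = fromPred (c + m) (colPred (toℕ j)) , ∣colPred∣ (toℕ<n j)

  rowPred⁻ : ∀ i q → T (rowPred i q) → q < c ⊎ q ≡ c + i
  rowPred⁻ i q q∈ with to (T-∨ {interval 0 c q}) q∈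
  ... | inj₁ q∈core  = inj₁ (proj₂ (interval⁻ 0 c q q∈core))
  ... | inj₂ q∈point = inj₂ (interval-singleton (c + i) q q∈point)

  colPred⁻ : ∀ j q → T (colPred j q) → (c + j ≤ q × q < c + j + suc c) ⊎ (c ≤ q × q < c + wrap j)
  colPred⁻ j q q∈ with to (T-∨ {interval (c + j) (suc c) q}) q∈
  ... | inj₁ q∈window = inj₁ (interval⁻ (c + j) (suc c) q q∈window)
  ... | inj₂ q∈wrap   = inj₂ (interval⁻ c (wrap j) q q∈wrap)

  meets⇒window : ∀ i {j} → j < m → ∀ q → T (rowPred i q) → T (colPred j q) → Window m (suc c) j i
  meets⇒window i {j} j<m q q∈row q∈col with rowPred⁻ i q q∈row | colPred⁻ j q q∈col
  ... | inj₁ q<c  | inj₁ (c+j≤q , _) = ⊥-elim (<⇒≱ q<c (≤-trans (m≤m+n c j) c+j≤q))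
  ... | inj₁ q<c  | inj₂ (c≤q , _)   = ⊥-elim (<⇒≱ q<c c≤q)
  ... | inj₂ refl | inj₁ (c+j≤c+i , c+i<c+j+t) =
    inj₁ ( +-cancelˡ-≤ c j i c+j≤c+i
         , +-cancelˡ-< c i (j + suc c) (subst (c + i <_) (+-assoc c j (suc c)) c+i<c+j+t))
  ... | inj₂ refl | inj₂ (_ , c+i<c+wrap) = inj₂ (begin-strict
    i + m               ≡⟨ cong (i +_) (sym (m∸n+n≡m (<⇒≤ j<m))) ⟩
    i + ((m ∸ j) + j)   ≡⟨ sym (+-assoc i (m ∸ j) j) ⟩
    i + (m ∸ j) + j     <⟨ +-monoˡ-< j (m<n∸o⇒m+o<n i (suc c) (m ∸ j)
                                          (+-cancelˡ-< c i (wrap j) c+i<c+wrap)) ⟩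
    suc c + j           ≡⟨ +-comm (suc c) j ⟩
    j + suc c           ∎)
    where open ≤-Reasoning

  ones : ∀ i → A (c + m) (suc c) (row i) (col i)
  ones i = point , at-point (rowPred (toℕ i)) (from T-∨ (inj₂ (start∈interval (c + toℕ i) 0)))
                 , at-point (colPred (toℕ i)) (from T-∨ (inj₁ (start∈interval (c + toℕ i) c)))
    where
    point : Fin (c + m)
    point = c ↑ʳ i
    at-point : (f : ℕ → Bool) → T (f (c + toℕ i)) → point ∈ fromPred (c + m) f
    at-point f fci = ∈fromPred⁺ f point (subst (T ∘ f) (sym (toℕ-↑ʳ c i)) fci)

  isolationSet : IsolationSet (A (c + m) (suc c)) m
  isolationSet = isolationSet-fromAntisymmetric
    (λ i j → Window m (suc c) (toℕ j) (toℕ i)) row col ones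
    (λ {i} {j} (q , q∈row , q∈col) → meets⇒window (toℕ i) (toℕ<n j) (toℕ q)
        (∈fromPred⁻ (rowPred (toℕ i)) q q∈row) (∈fromPred⁻ (colPred (toℕ j)) q q∈col))
    (λ i≼j j≼i → toℕ-injective (window-antisym t+t≤1+m i≼j j≼i))

lemma4 : (t k : ℕ) → 2 ≤ t → 3 * t ∸ 2 ≤ k →
         IsolationSet (A k t) (k ∸ t + 1)
lemma4 (suc c) k (s≤s _) 3t∸2≤k =
  subst (λ n → IsolationSet (A n (suc c)) m) c+m≡k (Construction.isolationSet c m c+c<m)
  where
  m : ℕ
  m = k ∸ suc c + 1
  t+[c+c]≤k : suc c + (c + c) ≤ k
  t+[c+c]≤k = subst (_≤ k) (trans (cong (_∸ 2) (three-times c)) (m+n∸m≡n 2 (suc c + (c + c))))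
                    3t∸2≤k
    where
    three-times : ∀ c → 3 * suc c ≡ 2 + (suc c + (c + c))
    three-times = solve-∀
  t≤k : suc c ≤ k
  t≤k = ≤-trans (m≤m+n (suc c) (c + c)) t+[c+c]≤k
  c+m≡k : c + m ≡ k
  c+m≡k = trans (shift c (k ∸ suc c)) (m+[n∸m]≡n t≤k)
    where
    shift : ∀ c x → c + (x + 1) ≡ suc c + x
    shift = solve-∀
  c+c<m : c + c < m
  c+c<m = subst (_≤ m) (+-comm (c + c) 1) (+-monoˡ-≤ 1 (m+n≤o⇒m≤o∸n (c + c)
            (subst (_≤ k) (+-comm (suc c) (c + c)) t+[c+c]≤k)))
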